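{- For $n\ge1$ let $\mathcal{S}_n$ be the parity game with vertex set $\{v_0,\dots,v_{2n-1},u_1,\dots,u_n\}$, all vertices owned by player $\Diamond$, where $v_0$ has priority $2$ and only successor $v_0$; for $1\le i<2n$, $v_i$ has priority $i+2$ and only successor $v_{i-1}$; and for $1\le j\le n$, $u_j$ has priority $1$ and successors $u_j$ and $v_{2j-1}$. Then, for $n>0$, solving $\mathcal{S}_n$ with Zielonka's recursive algorithm requires at least $2^n$ calls to $\textsc{Zielonka}$.
   Context: A parity game $G=(V,E,\mathcal{P},(V_\Diamond,V_\Box))$ consists of a finite vertex set $V$ partitioned into $V_\Diamond$ (owned by player even, $\Diamond$) and $V_\Box$ (owned by player odd, $\Box$), a total edge relation $E$ and a priority function $\mathcal{P}:V\to\mathbb{N}$. Player $\Diamond$ wins an infinite play iff the highest priority occurring infinitely often is even; solving means computing the winning regions $(W_\Diamond,W_\Box)$. For $A\subseteq V$, $G\setminus A$ is the restriction of $G$ to $V\setminus A$; $\overline i$ is the opponent of $i$. The $i$-attractor $\mathit{Attr}_i(U)$ is the least superset of $U$ closed under adding vertices of $V_i$ with some successor in the set and vertices of $V_{\overline i}$ all of whose successors are in the set. Zielonka's algorithm $\textsc{Zielonka}(G)$: if $V=\emptyset$ return $(\emptyset,\emptyset)$. Otherwise let $m$ be the maximal priority, $p=\Diamond$ if $m$ even else $\Box$, $U=\{v\mid\mathcal{P}(v)=m\}$, $A=\mathit{Attr}_p(U)$, $(W'_\Diamond,W'_\Box)=\textsc{Zielonka}(G\setminus A)$. If $W'_{\overline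 p}=\emptyset$ return $W_p=A\cup W'_p$, $W_{\overline p}=\emptyset$; else $B=\mathit{Attr}_{\overline p}(W'_{\overline p})$, $(W''_\Diamond,W''_\Box)=\textsc{Zielonka}(G\setminus B)$, return $W_p=W''_p$, $W_{\overline p}=W''_{\overline p}\cup B$. -}

module Defs where

open import Data.Nat using (ℕ; zero; suc; _+_; _*_; _∸_; _⊔_; _≡ᵇ_; _<ᵇ_)
open import Data.Bool using (Bool; true; false; _∧_; _∨_; not; if_then_else_)
open import Data.Fin using (Fin; toℕ)
open import Data.List using (List; foldr; allFin)
open import Data.Bool.ListAction using (any; all)
open import Relation.Binary.PropositionalEquality using (_≡_)
open import Data.Product using (_×_; _,_; proj₁; proj₂)

data Player : Set where
  ◇ □ : Player      -- ◇ = player even, □ = player odd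

opp : Player → Player
opp ◇ = □
opp □ = ◇

_==ᴾ_ : Player → Player → Bool
◇ ==ᴾ ◇ = true
□ ==ᴾ □ = true
_ ==ᴾ _ = false

parityPlayer : ℕ → Player
parityPlayer zero          = ◇
parityPlayer (suc zero)    = □
parityPlayer (suc (suc m)) = parityPlayer m

record Game (N : ℕ) : Set where
  field
    owner : Fin N → Player
    prio  : Fin N → ℕ
    edge  : Fin N → Fin N → Bool

open Game public

Total : ∀ {N} → Game N → Set
Total {N} G = (v : Fin N) → any (edge G v) (allFin N) ≡ true

VSet : ℕ → Set
VSet N = Fin N → Bool

∅ˢ : ∀ {N} → VSet N
∅ˢ _ = false

fullˢ : ∀ {N} → VSet N
fullˢ _ = true

_∪ˢ_ : ∀ {N} → VSet N → VSet N → VSet N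
(X ∪ˢ Y) v = X v ∨ Y v

_∩ˢ_ : ∀ {N} → VSet N → VSet N → VSet N
(X ∩ˢ Y) v = X v ∧ Y v

_∖ˢ_ : ∀ {N} → VSet N → VSet N → VSet N
(X ∖ˢ Y) v = X v ∧ not (Y v)

nonEmpty : ∀ {N} → VSet N → Bool
nonEmpty {N} X = any X (allFin N)

-- maximal priority in S (only used when S ≠ ∅)
maxPrio : ∀ {N} → Game N → VSet N → ℕ
maxPrio {N} G S = foldr (λ v acc → if S v then prio G v ⊔ acc else acc) 0 (allFin N)

attrStep : ∀ {N} → Game N → Player → VSet N → VSet N → VSet N
attrStep {N} G i S X v =
  X v ∨ (S v ∧ (if owner G v ==ᴾ i
                 then any (λ w → S w ∧ edge G v w ∧ X w) (allFin N)
                 else all (λ w → not (S w ∧ edge G v w) ∨ X w) (allFin N)))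

iterateˢ : ∀ {A : Set} → ℕ → (A → A) → A → A
iterateˢ zero    f x = x
iterateˢ (suc k) f x = iterateˢ k f (f x)

-- Attr_i(U) in the subgame on S: the least fixed point, reached after at most
-- N iterations of the (monotone, inflationary) step operator.
attr : ∀ {N} → Game N → Player → VSet N → VSet N → VSet N
attr {N} G i S U = iterateˢ N (attrStep G i S) (U ∩ˢ S)

sel : ∀ {A : Set} → Player → A × A → A
sel ◇ w = proj₁ w
sel □ w = proj₂ w

mkW : ∀ {A : Set} → Player → A → A → A × A
mkW ◇ wp wq = wp , wq
mkW □ wp wq = wq , wp

-- Zielonka's recursive algorithm, instrumented with a call counter.
-- zielonkaF G fuel S returns ((W◇ , W□) , number of calls to Zielonka made,
-- including this one) for the subgame G restricted to S.  Every recursive call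
-- is on a strictly smaller vertex set, so fuel = N + 1 is never exhausted.

zielonkaF : ∀ {N} → Game N → ℕ → VSet N → (VSet N × VSet N) × ℕ
zielonkaF G zero    S = (∅ˢ , ∅ˢ) , 0
zielonkaF G (suc k) S with nonEmpty S
... | false = (∅ˢ , ∅ˢ) , 1
... | true  =
  let m   = maxPrio G S
      p   = parityPlayer m
      U   = λ v → S v ∧ (prio G v ≡ᵇ m)
      A   = attr G p S U
      r₁  = zielonkaF G k (S ∖ˢ A)
      W'  = proj₁ r₁
      c₁  = proj₂ r₁
  in if nonEmpty (sel (opp p) W')
     then (let B  = attr G (opp p) S (sel (opp p) W')
               r₂ = zielonkaF G k (S ∖ˢ B)
               W'' = proj₁ r₂
           in mkW p (sel p W'') (sel (opp p) W'' ∪ˢ B) , suc (c₁ + proj₂ r₂))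
     else (mkW p (A ∪ˢ sel p W') ∅ˢ , suc c₁)

zielonka : ∀ {N} → Game N → VSet N × VSet N
zielonka {N} G = proj₁ (zielonkaF G (suc N) fullˢ)

zielonkaCalls : ∀ {N} → Game N → ℕ
zielonkaCalls {N} G = proj₂ (zielonkaF G (suc N) fullˢ)

-- The game S_n, with 3n vertices:
--   index k < 2n       is v_k
--   index 2n + (j - 1) is u_j   (1 ≤ j ≤ n)

Sn : (n : ℕ) → Game (2 * n + n)
Sn n = record
  { owner = λ _ → ◇
  ; prio  = λ x → if toℕ x <ᵇ 2 * n then toℕ x + 2 else 1
  ; edge  = λ x y →
      let k = toℕ x ; l = toℕ y in
      if k <ᵇ 2 * n
      then (if k ≡ᵇ 0 then l ≡ᵇ 0 else l ≡ᵇ (k ∸ 1))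
      -- u_j with j = k ∸ 2n + 1: successors u_j and v_{2j-1} = v_{2(k ∸ 2n)+1}
      else ((l ≡ᵇ k) ∨ (l ≡ᵇ suc (2 * (k ∸ 2 * n))))
  }

-- Write G(k, M) for the subgame of S_n on v_0, …, v_{k-1} and u_1, …, u_M, where ⌊k/2⌋ ≤ M, i.e.
-- every u_j whose successor v_{2j-1} lies in G(k, M) is present.  Player ◇ wins the v_i and the u_j
-- whose successor lies in G(k, M); player □ wins the other u_j.  Zielonka's algorithm on G(k, M)
-- removes the top vertex v_{k-1}, whose attractor is just itself, and recurses on G(k-1, M).
-- If k-1 is odd, ◇ then attracts v_{k-1} and u_{k/2}, and the rest is won by □ in a single further
-- call.  If k-1 = 2h is even and h < M, player □ wins u_{h+1}, …, u_M in G(k-1, M), so the algorithm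
-- makes a second recursive call, on G(k, h).  The number of calls T(k, M) therefore satisfies
-- T(2h+1, M) ≥ T(2h, M) + T(2h+1, h) for h < M and T(2h+2, M) ≥ T(2h+1, M), whence
-- T(k, M) ≥ 2^(⌈k/2⌉ ⊓ M) and T(2n, n) ≥ 2^n.

module Submission where

open import Defs
open import Data.Nat
  using (ℕ; zero; suc; _+_; _*_; _∸_; _^_; _≤_; _<_; _⊔_; _⊓_; _≡ᵇ_; _<ᵇ_; z≤n; s≤s; ⌊_/2⌋; ⌈_/2⌉)
open import Data.Nat.Properties
open import Data.Bool using (Bool; true; false; _∧_; _∨_; not; if_then_else_)
open import Data.Bool.Properties
  using (T-≡; ¬-not; ∧-identityʳ; ∧-zeroʳ; ∧-inverseʳ; ∨-identityʳ; ∨-zeroʳ) renaming (_≟_ to _≟ᴮ_)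
open import Data.Bool.ListAction using (any; all; or; and)
open import Data.Fin using (Fin; toℕ; fromℕ<)
open import Data.Fin.Properties using (toℕ-fromℕ<; toℕ<n)
open import Data.List using ([]; _∷_; foldr; allFin)
open import Data.List.Properties using (map-cong)
open import Data.List.Membership.Propositional using (_∈_; lose)
open import Data.List.Membership.Propositional.Properties using (∈-allFin)
open import Data.List.Relation.Unary.Any using (here; there; satisfied)
open import Data.List.Relation.Unary.Any.Properties using (any⁺; any⁻)
open import Data.Product using (_×_; _,_; proj₁; proj₂; ∃)
open import Function using (_∘_; Equivalence)
open import Relation.Nullary using (Dec; yes; no; contradiction)
open import Relation.Binary.PropositionalEquality

open Equivalence

≡ᵇ-refl : ∀ m → (m ≡ᵇ m) ≡ true
≡ᵇ-refl m = to T-≡ (≡⇒≡ᵇ m m refl)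

≡ᵇ-true⇒ : ∀ {m n} → (m ≡ᵇ n) ≡ true → m ≡ n
≡ᵇ-true⇒ {m} {n} e = ≡ᵇ⇒≡ m n (from T-≡ e)

≡ᵇ-false : ∀ {m n} → m ≢ n → (m ≡ᵇ n) ≡ false
≡ᵇ-false m≢n = ¬-not (m≢n ∘ ≡ᵇ-true⇒)

<ᵇ-true : ∀ {m n} → m < n → (m <ᵇ n) ≡ true
<ᵇ-true m<n = to T-≡ (<⇒<ᵇ m<n)

<ᵇ-true⇒ : ∀ {m n} → (m <ᵇ n) ≡ true → m < n
<ᵇ-true⇒ {m} {n} e = <ᵇ⇒< m n (from T-≡ e)

<ᵇ-false : ∀ {m n} → n ≤ m → (m <ᵇ n) ≡ false
<ᵇ-false n≤m = ¬-not (λ e → <⇒≱ (<ᵇ-true⇒ e) n≤m)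

<ᵇ-false⇒ : ∀ {m n} → (m <ᵇ n) ≡ false → n ≤ m
<ᵇ-false⇒ e = ≮⇒≥ (λ m<n → contradiction (trans (sym (<ᵇ-true m<n)) e) λ ())

≡ᵇ-∸ : ∀ {c l k} → c ≤ l → c ≤ k → (l ≡ᵇ k) ≡ (l ∸ c ≡ᵇ k ∸ c)
≡ᵇ-∸ z≤n       z≤n       = refl
≡ᵇ-∸ (s≤s c≤l) (s≤s c≤k) = ≡ᵇ-∸ c≤l c≤k

≡ᵇ∧<ᵇ : ∀ i k → (i ≡ᵇ k) ∧ (i <ᵇ k) ≡ false
≡ᵇ∧<ᵇ zero    zero    = refl
≡ᵇ∧<ᵇ zero    (suc k) = refl
≡ᵇ∧<ᵇ (suc i) zero    = refl
≡ᵇ∧<ᵇ (suc i) (suc k) = ≡ᵇ∧<ᵇ i k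

<ᵇ-suc : ∀ i k → (i <ᵇ suc k) ≡ (i ≡ᵇ k) ∨ (i <ᵇ k)
<ᵇ-suc zero    zero    = refl
<ᵇ-suc zero    (suc k) = refl
<ᵇ-suc (suc i) zero    = refl
<ᵇ-suc (suc i) (suc k) = <ᵇ-suc i k

<ᵇ-suc∧≢ : ∀ i k → (i <ᵇ suc k) ∧ not (i ≡ᵇ k) ≡ (i <ᵇ k)
<ᵇ-suc∧≢ i k rewrite <ᵇ-suc i k with i ≡ᵇ k | i <ᵇ k | ≡ᵇ∧<ᵇ i k
... | true  | true  | ()
... | true  | false | _ = refl
... | false | _     | _ = ∧-identityʳ _

<ᵇ-pred : ∀ {i k} → (i <ᵇ k) ≡ true → (i ∸ 1 <ᵇ k) ≡ true
<ᵇ-pred {i} {k} i<k = <ᵇ-true (≤-<-trans (m∸n≤m i 1) (<ᵇ-true⇒ {i} {k} i<k))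

odd-<ᵇ : ∀ j k → (suc (2 * j) <ᵇ k) ≡ (j <ᵇ ⌊ k /2⌋)
odd-<ᵇ j       zero          = refl
odd-<ᵇ j       (suc zero)    = refl
odd-<ᵇ zero    (suc (suc k)) = refl
odd-<ᵇ (suc j) (suc (suc k)) rewrite +-suc j (j + 0) = odd-<ᵇ j k

2j+1<2n : ∀ {j n} → j < n → suc (2 * j) < 2 * n
2j+1<2n {j} {n} j<n = subst (_≤ 2 * n) (*-suc 2 j) (*-monoʳ-≤ 2 j<n)

parity-odd : ∀ j → parityPlayer (suc (2 * j)) ≡ □
parity-odd zero    = refl
parity-odd (suc j) rewrite +-suc j (j + 0) = parity-odd j

odd≢even : ∀ {j k} → parityPlayer k ≡ ◇ → suc (2 * j) ≢ k
odd≢even {j} even refl with () ← trans (sym (parity-odd j)) even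

odd<ᵇsuc-even : ∀ {j k} → parityPlayer k ≡ ◇ → (suc (2 * j) <ᵇ suc k) ≡ (suc (2 * j) <ᵇ k)
odd<ᵇsuc-even {j} {k} even =
  trans (<ᵇ-suc (suc (2 * j)) k) (cong (_∨ (suc (2 * j) <ᵇ k)) (≡ᵇ-false {suc (2 * j)} {k} (odd≢even {j} even)))

odd⇒positive : ∀ {k} → parityPlayer k ≡ □ → 0 < k
odd⇒positive {suc k} _ = s≤s z≤n

⌊suc/2⌋-even : ∀ {k} → parityPlayer k ≡ ◇ → ⌊ suc k /2⌋ ≡ ⌊ k /2⌋
⌊suc/2⌋-even {zero}        _    = refl
⌊suc/2⌋-even {suc (suc k)} even = cong suc (⌊suc/2⌋-even even)

⌊suc/2⌋-odd : ∀ {k} → parityPlayer k ≡ □ → ⌊ suc k /2⌋ ≡ suc ⌊ k /2⌋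
⌊suc/2⌋-odd {suc zero}    _   = refl
⌊suc/2⌋-odd {suc (suc k)} odd = cong suc (⌊suc/2⌋-odd odd)

⌊2n/2⌋≡n : ∀ n → ⌊ 2 * n /2⌋ ≡ n
⌊2n/2⌋≡n zero    = refl
⌊2n/2⌋≡n (suc n) rewrite +-suc n (n + 0) = cong suc (⌊2n/2⌋≡n n)

⌈2n/2⌉≡n : ∀ n → ⌈ 2 * n /2⌉ ≡ n
⌈2n/2⌉≡n zero    = refl
⌈2n/2⌉≡n (suc n) rewrite +-suc n (n + 0) = cong suc (⌈2n/2⌉≡n n)

2^-double : ∀ {h c₁ c₂} → 2 ^ h ≤ c₁ → 2 ^ h ≤ c₂ → 2 ^ suc h ≤ suc (c₁ + c₂)
2^-double {h} {c₁} {c₂} b₁ b₂ =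
  m≤n⇒m≤1+n (subst (_≤ c₁ + c₂) (cong (2 ^ h +_) (sym (+-identityʳ (2 ^ h)))) (+-mono-≤ b₁ b₂))

∧-true⇒ : ∀ a {b} → a ∧ b ≡ true → a ≡ true × b ≡ true
∧-true⇒ true {true} _ = refl , refl

bool-ext : ∀ {a b : Bool} → (a ≡ true → b ≡ true) → (b ≡ true → a ≡ true) → a ≡ b
bool-ext {false} {false} _ _ = refl
bool-ext {false} {true}  _ g = g refl
bool-ext {true}  {false} f _ = sym (f refl)
bool-ext {true}  {true}  _ _ = refl

all≡not-any-not : ∀ {A : Set} (f : A → Bool) xs → all f xs ≡ not (any (not ∘ f) xs)
all≡not-any-not f []       = refl
all≡not-any-not f (x ∷ xs) with f x
... | true  = all≡not-any-not f xs
... | false = refl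

iterate-fixpoint : ∀ {A B : Set} {f : (A → B) → A → B} {Z : A → B} →
                   (∀ {X Y} → X ≗ Y → f X ≗ f Y) → f Z ≗ Z →
                   ∀ {j K} → j ≤ K → ∀ X → iterateˢ j f X ≗ Z → iterateˢ K f X ≗ Z
iterate-fixpoint f-cong fZ≗Z {zero} {zero}  _         X X≗Z = X≗Z
iterate-fixpoint f-cong fZ≗Z {zero} {suc K} _         X X≗Z =
  iterate-fixpoint f-cong fZ≗Z {zero} {K} z≤n _ (λ v → trans (f-cong X≗Z v) (fZ≗Z v))
iterate-fixpoint f-cong fZ≗Z {suc j} {suc K} (s≤s j≤K) X fX≗Z =
  iterate-fixpoint f-cong fZ≗Z j≤K _ fX≗Z

module ZielonkaFacts {N : ℕ} (G : Game N) where

  nonEmpty-intro : ∀ {X : VSet N} x → X x ≡ true → nonEmpty X ≡ true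
  nonEmpty-intro {X} x Xx = to T-≡ (any⁺ X (lose (∈-allFin x) (from T-≡ Xx)))

  nonEmpty-elim : ∀ {X : VSet N} → nonEmpty X ≡ true → ∃ λ x → X x ≡ true
  nonEmpty-elim {X} e with satisfied (any⁻ X (allFin N) (from T-≡ e))
  ... | x , Xx = x , to T-≡ Xx

  nonEmpty-≡-false : ∀ {X : VSet N} → (∀ x → X x ≡ false) → nonEmpty X ≡ false
  nonEmpty-≡-false {X} empty with nonEmpty X in e
  ... | false = refl
  ... | true with nonEmpty-elim e
  ...   | x , Xx with () ← trans (sym Xx) (empty x)

  nonEmpty-false⇒ : ∀ {X : VSet N} → nonEmpty X ≡ false → ∀ x → X x ≡ false
  nonEmpty-false⇒ {X} e x with X x in Xx
  ... | false = refl
  ... | true with () ← trans (sym (nonEmpty-intro x Xx)) e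

  maxPrio-≡ : ∀ {S m} x → S x ≡ true → prio G x ≡ m → (∀ y → S y ≡ true → prio G y ≤ m) →
              maxPrio G S ≡ m
  maxPrio-≡ {S} {m} x Sx refl bounded =
    ≤-antisym (fold-≤ (allFin N)) (≤-fold (∈-allFin x))
    where
      step : Fin N → ℕ → ℕ
      step v acc = if S v then prio G v ⊔ acc else acc
      fold-≤ : ∀ vs → foldr step 0 vs ≤ m
      fold-≤ []       = z≤n
      fold-≤ (v ∷ vs) with S v in Sv
      ... | true  = ⊔-lub (bounded v Sv) (fold-≤ vs)
      ... | false = fold-≤ vs
      ≤-fold : ∀ {vs} → x ∈ vs → prio G x ≤ foldr step 0 vs
      ≤-fold {v ∷ vs} (here refl) rewrite Sx = m≤m⊔n (prio G x) _
      ≤-fold {v ∷ vs} (there x∈vs) with S v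
      ... | true  = ≤-trans (≤-fold x∈vs) (m≤n⊔m (prio G v) _)
      ... | false = ≤-fold x∈vs

  attrStep-cong : ∀ p {S S′ X X′ : VSet N} → S ≗ S′ → X ≗ X′ → attrStep G p S X ≗ attrStep G p S′ X′
  attrStep-cong p {S} {S′} S≗ X≗ v =
    cong₂ _∨_ (X≗ v) (cong₂ _∧_ (S≗ v) (cong₂ (if owner G v ==ᴾ p then_else_)
      (cong or (map-cong (λ w → cong₂ (λ s x → s ∧ edge G v w ∧ x) (S≗ w) (X≗ w)) (allFin N)))
      (cong and (map-cong (λ w → cong₂ (λ s x → not (s ∧ edge G v w) ∨ x) (S≗ w) (X≗ w)) (allFin N)))))

  attr-≗ : ∀ p S U {X} j → j ≤ N → iterateˢ j (attrStep G p S) (U ∩ˢ S) ≗ X →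
           attrStep G p S X ≗ X → attr G p S U ≗ X
  attr-≗ p S U j j≤N reach fixed = iterate-fixpoint (attrStep-cong p (λ _ → refl)) fixed j≤N (U ∩ˢ S) reach

  zielonkaF-on-empty : ∀ {f S} → (∀ x → S x ≡ false) → zielonkaF G (suc f) S ≡ ((∅ˢ , ∅ˢ) , 1)
  zielonkaF-on-empty empty rewrite nonEmpty-≡-false empty = refl

  module Unfold (f : ℕ) (S : VSet N) (m : ℕ) (p : Player) where

    A : VSet N
    A = attr G p S (λ v → S v ∧ (prio G v ≡ᵇ m))

    first : (VSet N × VSet N) × ℕ
    first = zielonkaF G f (S ∖ˢ A)

    B : VSet N
    B = attr G (opp p) S (sel (opp p) (proj₁ first))

    second : (VSet N × VSet N) × ℕ
    second = zielonkaF G f (S ∖ˢ B)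

    module _ (S≢∅ : nonEmpty S ≡ true) (max≡m : maxPrio G S ≡ m) (p≡ : parityPlayer m ≡ p) where

      unfold-no-second : nonEmpty (sel (opp p) (proj₁ first)) ≡ false →
        zielonkaF G (suc f) S ≡ (mkW p (A ∪ˢ sel p (proj₁ first)) ∅ˢ , suc (proj₂ first))
      unfold-no-second e rewrite S≢∅ | max≡m | p≡ | e = refl

      unfold-second : nonEmpty (sel (opp p) (proj₁ first)) ≡ true →
        zielonkaF G (suc f) S ≡
          (mkW p (sel p (proj₁ second)) (sel (opp p) (proj₁ second) ∪ˢ B) , suc (proj₂ first + proj₂ second))
      unfold-second e rewrite S≢∅ | max≡m | p≡ | e = refl

  sel-diag : ∀ {A : Set} p (a : A) → sel p (a , a) ≡ a
  sel-diag ◇ a = refl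
  sel-diag □ a = refl

  sel-mkW : ∀ {A : Set} p (a b : A) → sel p (mkW p a b) ≡ a
  sel-mkW ◇ a b = refl
  sel-mkW □ a b = refl

  sel-opp-mkW : ∀ {A : Set} p (a b : A) → sel (opp p) (mkW p a b) ≡ b
  sel-opp-mkW ◇ a b = refl
  sel-opp-mkW □ a b = refl

  Computes : Player → VSet N → VSet N → ℕ → (VSet N × VSet N) × ℕ → Set
  Computes p Wp Wp̄ c r = sel p (proj₁ r) ≗ Wp × sel (opp p) (proj₁ r) ≗ Wp̄ × c ≤ proj₂ r

  zielonkaF-uniform : ∀ {f S m} → 2 ≤ f → (∀ x → S x ≡ true → prio G x ≡ m) →
                      Computes (parityPlayer m) S ∅ˢ 1 (zielonkaF G f S)
  zielonkaF-uniform {suc (suc f)} {S} {m} (s≤s (s≤s z≤n)) prio≡m with nonEmpty S ≟ᴮ true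
  ... | no S-empty = subst (Computes p S ∅ˢ 1) (sym (zielonkaF-on-empty (nonEmpty-false⇒ (¬-not S-empty))))
                   ((λ x → trans (cong (λ X → X x) (sel-diag p ∅ˢ)) (sym (nonEmpty-false⇒ (¬-not S-empty) x))) ,
                    (λ x → cong (λ X → X x) (sel-diag (opp p) ∅ˢ)) , s≤s z≤n)
    where p = parityPlayer m
  ... | yes S≢∅ = subst (Computes p S ∅ˢ 1) (sym (unfold-no-second S≢∅ max≡m refl nothing-lost))
                    ((λ v → trans (cong (λ X → X v) (sel-mkW p _ ∅ˢ)) (won v)) ,
                     (λ v → cong (λ X → X v) (sel-opp-mkW p _ ∅ˢ)) , s≤s z≤n)
    where
      p = parityPlayer m
      open Unfold (suc f) S m p

      max≡m : maxPrio G S ≡ m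
      max≡m with x , Sx ← nonEmpty-elim S≢∅ =
        maxPrio-≡ x Sx (prio≡m x Sx) (λ y Sy → ≤-reflexive (prio≡m y Sy))

      A≗S : A ≗ S
      A≗S = attr-≗ p S _ 0 z≤n top≗S fixed
        where
          top≗S : ((λ v → S v ∧ (prio G v ≡ᵇ m)) ∩ˢ S) ≗ S
          top≗S v with S v in Sv
          ... | false = refl
          ... | true rewrite prio≡m v Sv | ≡ᵇ-refl m = refl
          fixed : attrStep G p S S ≗ S
          fixed v with S v
          ... | false = refl
          ... | true  = refl

      first≡ : first ≡ ((∅ˢ , ∅ˢ) , 1)
      first≡ = zielonkaF-on-empty λ v → trans (cong (λ b → S v ∧ not b) (A≗S v)) (∧-inverseʳ (S v))

      nothing-lost : nonEmpty (sel (opp p) (proj₁ first)) ≡ false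
      nothing-lost rewrite first≡ | sel-diag (opp p) (∅ˢ {N}) = nonEmpty-≡-false (λ _ → refl)

      won : (A ∪ˢ sel p (proj₁ first)) ≗ S
      won v rewrite first≡ | sel-diag p (∅ˢ {N}) = trans (∨-identityʳ (A v)) (A≗S v)

-- S_n with unbounded indices: v i and u j stand for the paper's v_i and u_{j+1}, and every vertex
-- belongs to ◇.

data Vertex : Set where
  v u : ℕ → Vertex

priority : Vertex → ℕ
priority (v i) = 2 + i
priority (u j) = 1

edgeᵛ : Vertex → Vertex → Bool
edgeᵛ (v i) (v i′) = i′ ≡ᵇ i ∸ 1
edgeᵛ (v i) (u j′) = false
edgeᵛ (u j) (v i′) = i′ ≡ᵇ suc (2 * j)
edgeᵛ (u j) (u j′) = j′ ≡ᵇ j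

someSucc : (Vertex → Bool) → Vertex → Bool
someSucc Y (v i) = Y (v (i ∸ 1))
someSucc Y (u j) = Y (u j) ∨ Y (v (suc (2 * j)))

attrStepᵛ : Player → (Vertex → Bool) → (Vertex → Bool) → Vertex → Bool
attrStepᵛ ◇ S X a = X a ∨ (S a ∧ someSucc (λ b → S b ∧ X b) a)
attrStepᵛ □ S X a = X a ∨ (S a ∧ not (someSucc (λ b → S b ∧ not (X b)) a))

edgeᵛ-someSucc : ∀ Y a b → edgeᵛ a b ∧ Y b ≡ true → someSucc Y a ≡ true
edgeᵛ-someSucc Y (v i) (v i′) e with ∧-true⇒ (i′ ≡ᵇ i ∸ 1) e
... | i′≡ , Yb = subst (λ k → Y (v k) ≡ true) (≡ᵇ-true⇒ i′≡) Yb
edgeᵛ-someSucc Y (u j) (v i′) e with ∧-true⇒ (i′ ≡ᵇ suc (2 * j)) e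
... | i′≡ , Yb =
  trans (cong (Y (u j) ∨_) (subst (λ k → Y (v k) ≡ true) (≡ᵇ-true⇒ i′≡) Yb)) (∨-zeroʳ (Y (u j)))
edgeᵛ-someSucc Y (u j) (u j′) e with ∧-true⇒ (j′ ≡ᵇ j) e
... | j′≡ , Yb = cong (_∨ Y (v (suc (2 * j)))) (subst (λ k → Y (u k) ≡ true) (≡ᵇ-true⇒ j′≡) Yb)

module Decoding (n : ℕ) where

  private
    N : ℕ
    N = 2 * n + n

    v-edge : ∀ k l → (if k ≡ᵇ 0 then l ≡ᵇ 0 else l ≡ᵇ (k ∸ 1)) ≡ (l ≡ᵇ k ∸ 1)
    v-edge zero    l = refl
    v-edge (suc k) l = refl

  open ZielonkaFacts (Sn n)

  decode : Fin N → Vertex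
  decode x = if toℕ x <ᵇ 2 * n then v (toℕ x) else u (toℕ x ∸ 2 * n)

  InRange : Vertex → Set
  InRange (v i) = i < 2 * n
  InRange (u j) = j < n

  u-index< : ∀ (x : Fin N) → 2 * n ≤ toℕ x → toℕ x ∸ 2 * n < n
  u-index< x 2n≤x = subst (toℕ x ∸ 2 * n <_) (m+n∸m≡n (2 * n) n) (∸-monoˡ-< (toℕ<n x) 2n≤x)

  decode-inRange : ∀ x → InRange (decode x)
  decode-inRange x with toℕ x <ᵇ 2 * n in x<2n
  ... | true  = <ᵇ-true⇒ x<2n
  ... | false = u-index< x (<ᵇ-false⇒ x<2n)

  decode-v : ∀ x {i} → toℕ x ≡ i → i < 2 * n → decode x ≡ v i
  decode-v x refl i<2n rewrite <ᵇ-true i<2n = refl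

  decode-u : ∀ x {j} → toℕ x ≡ 2 * n + j → decode x ≡ u j
  decode-u x {j} x≡ rewrite x≡ | <ᵇ-false {2 * n + j} (m≤m+n (2 * n) j) = cong u (m+n∸m≡n (2 * n) j)

  decode-onto : ∀ a → InRange a → ∃ λ x → decode x ≡ a
  decode-onto (v i) i<2n = _ , decode-v (fromℕ< i<N) (toℕ-fromℕ< i<N) i<2n
    where i<N = <-≤-trans i<2n (m≤m+n (2 * n) n)
  decode-onto (u j) j<n = _ , decode-u (fromℕ< 2n+j<N) (toℕ-fromℕ< 2n+j<N)
    where 2n+j<N = +-monoʳ-< (2 * n) j<n

  prio-decode : ∀ x → prio (Sn n) x ≡ priority (decode x)
  prio-decode x with toℕ x <ᵇ 2 * n
  ... | true  = +-comm (toℕ x) 2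
  ... | false = refl

  edge-decode : ∀ x w → edge (Sn n) x w ≡ edgeᵛ (decode x) (decode w)
  edge-decode x w with toℕ x <ᵇ 2 * n in x<2n | toℕ w <ᵇ 2 * n in w<2n
  ... | true  | true  = v-edge (toℕ x) (toℕ w)
  ... | true  | false = trans (v-edge (toℕ x) (toℕ w)) (≡ᵇ-false λ w≡ →
                          <⇒≱ (≤-<-trans (m∸n≤m (toℕ x) 1) (<ᵇ-true⇒ x<2n)) (subst (2 * n ≤_) w≡ (<ᵇ-false⇒ w<2n)))
  ... | false | true
    rewrite ≡ᵇ-false {toℕ w} {toℕ x} (λ w≡x → <⇒≱ (<ᵇ-true⇒ w<2n) (subst (2 * n ≤_) (sym w≡x) (<ᵇ-false⇒ x<2n)))
    = refl
  ... | false | false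
    rewrite ≡ᵇ-false {toℕ w} {suc (2 * (toℕ x ∸ 2 * n))}
              (λ w≡ → <⇒≱ (2j+1<2n (u-index< x (<ᵇ-false⇒ x<2n))) (subst (2 * n ≤_) w≡ (<ᵇ-false⇒ w<2n)))
    = trans (∨-identityʳ _) (≡ᵇ-∸ {2 * n} (<ᵇ-false⇒ w<2n) (<ᵇ-false⇒ x<2n))

  someSucc-edgeᵛ : ∀ Y a → InRange a → someSucc Y a ≡ true →
                   ∃ λ b → InRange b × edgeᵛ a b ≡ true × Y b ≡ true
  someSucc-edgeᵛ Y (v i) i<2n Yb = v (i ∸ 1) , ≤-<-trans (m∸n≤m i 1) i<2n , ≡ᵇ-refl (i ∸ 1) , Yb
  someSucc-edgeᵛ Y (u j) j<n e with Y (u j) in Yu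
  ... | true  = u j , j<n , ≡ᵇ-refl j , Yu
  ... | false = v (suc (2 * j)) , 2j+1<2n j<n , ≡ᵇ-refl (suc (2 * j)) , e

  any-edge : ∀ Y x → nonEmpty (λ w → edge (Sn n) x w ∧ Y (decode w)) ≡ someSucc Y (decode x)
  any-edge Y x = bool-ext to-succ from-succ
    where
      to-succ : nonEmpty (λ w → edge (Sn n) x w ∧ Y (decode w)) ≡ true → someSucc Y (decode x) ≡ true
      to-succ e with w , ew ← nonEmpty-elim e =
        edgeᵛ-someSucc Y (decode x) (decode w) (subst (λ b → b ∧ Y (decode w) ≡ true) (edge-decode x w) ew)
      from-succ : someSucc Y (decode x) ≡ true → nonEmpty (λ w → edge (Sn n) x w ∧ Y (decode w)) ≡ true
      from-succ e with b , b-in , eb , Yb ← someSucc-edgeᵛ Y (decode x) (decode-inRange x) e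
        with w , w↦b ← decode-onto b b-in =
        nonEmpty-intro w (cong₂ _∧_ (trans (edge-decode x w) (trans (cong (edgeᵛ (decode x)) w↦b) eb))
                                    (trans (cong Y w↦b) Yb))

  attrStep-decode : ∀ p (S X : Vertex → Bool) →
                    attrStep (Sn n) p (S ∘ decode) (X ∘ decode) ≗ attrStepᵛ p S X ∘ decode
  attrStep-decode ◇ S X x = cong (λ c → X (decode x) ∨ (S (decode x) ∧ c))
    (trans (cong or (map-cong (λ w → ∧-swap (S (decode w)) (edge (Sn n) x w) _) (allFin N)))
           (any-edge (λ b → S b ∧ X b) x))
    where
      ∧-swap : ∀ a b c → a ∧ (b ∧ c) ≡ b ∧ (a ∧ c)
      ∧-swap true  b c = refl
      ∧-swap false b c = sym (∧-zeroʳ b)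
  attrStep-decode □ S X x = cong (λ c → X (decode x) ∨ (S (decode x) ∧ c))
    (trans (all≡not-any-not _ (allFin N))
           (cong not (trans (cong or (map-cong (λ w → escape (S (decode w)) (edge (Sn n) x w) _) (allFin N)))
                            (any-edge (λ b → S b ∧ not (X b)) x))))
    where
      escape : ∀ s e c → not (not (s ∧ e) ∨ c) ≡ e ∧ (s ∧ not c)
      escape true  true  c = refl
      escape true  false c = refl
      escape false e     c = sym (∧-zeroʳ e)

prefix : ℕ → ℕ → Vertex → Bool
prefix k M (v i) = i <ᵇ k
prefix k M (u j) = j <ᵇ M

top : ℕ → Vertex → Bool
top k (v i) = i ≡ᵇ k
top k (u j) = false

won◇ : ℕ → Vertex → Bool
won◇ k (v i) = i <ᵇ k
won◇ k (u j) = suc (2 * j) <ᵇ k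

won□ : ℕ → ℕ → Vertex → Bool
won□ k M (v i) = false
won□ k M (u j) = (j <ᵇ M) ∧ not (suc (2 * j) <ᵇ k)

prefix-maxPriority≡top : ∀ k′ M a → (prefix (suc k′) M a ∧ (priority a ≡ᵇ 2 + k′)) ∧ prefix (suc k′) M a ≡ top k′ a
prefix-maxPriority≡top k′ M (v i) rewrite <ᵇ-suc i k′ with i ≡ᵇ k′ | i <ᵇ k′
... | true  | _     = refl
... | false | true  = refl
... | false | false = refl
prefix-maxPriority≡top k′ M (u j) with j <ᵇ M
... | true  = refl
... | false = refl

prefix-minus-top : ∀ k′ M a → prefix (suc k′) M a ∧ not (top k′ a) ≡ prefix k′ M a
prefix-minus-top k′ M (v i) = <ᵇ-suc∧≢ i k′
prefix-minus-top k′ M (u j) = ∧-identityʳ (j <ᵇ M)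

prefix-priority≤ : ∀ k′ M a → prefix (suc k′) M a ≡ true → priority a ≤ 2 + k′
prefix-priority≤ k′ M (v i) i<k = s≤s (<ᵇ-true⇒ i<k)
prefix-priority≤ k′ M (u j) _   = s≤s z≤n

top-◇-closed : ∀ {k′} M → parityPlayer k′ ≡ ◇ → ∀ a → attrStepᵛ ◇ (prefix (suc k′) M) (top k′) a ≡ top k′ a
top-◇-closed {k′} M even (v zero) with zero ≡ᵇ k′
... | true  = refl
... | false = refl
top-◇-closed {k′} M even (v (suc i)) with suc i ≡ᵇ k′ | i <ᵇ k′ | i ≡ᵇ k′ | ≡ᵇ∧<ᵇ i k′
... | _     | true  | true  | ()
... | w     | true  | false | _ = trans (cong (w ∨_) (∧-zeroʳ _)) (∨-identityʳ w)
... | w     | false | _     | _ = ∨-identityʳ w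
top-◇-closed {k′} M even (u j) with j <ᵇ M | 2 * j <ᵇ k′ | suc (2 * j) ≡ᵇ k′ in e
... | false | _     | _     = refl
... | true  | _     | false = ∧-zeroʳ _
... | true  | _     | true  = contradiction (≡ᵇ-true⇒ {suc (2 * j)} {k′} e) (odd≢even {j} even)

top-□-closed : ∀ k′ M a → attrStepᵛ □ (prefix (suc k′) M) (top k′) a ≡ top k′ a
top-□-closed k′ M (v zero) with zero ≡ᵇ k′
... | true  = refl
... | false = refl
top-□-closed k′ M (v (suc i)) rewrite <ᵇ-suc∧≢ i k′ | ∧-inverseʳ (i <ᵇ k′) = ∨-identityʳ _
top-□-closed k′ M (u j) with j <ᵇ M
... | true  = refl
... | false = refl

top∪won◇ : ∀ {k′} → parityPlayer k′ ≡ ◇ → ∀ a → top k′ a ∨ won◇ k′ a ≡ won◇ (suc k′) a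
top∪won◇ {k′} even (v i) = sym (<ᵇ-suc i k′)
top∪won◇ {k′} even (u j) = sym (odd<ᵇsuc-even {j} {k′} even)

won□-empty : ∀ {k M} → M ≤ ⌊ k /2⌋ → ∀ a → won□ k M a ≡ false
won□-empty         M≤h (v i) = refl
won□-empty {k} {M} M≤h (u j) with j <ᵇ M in j<M | suc (2 * j) <ᵇ k in odd<k
... | false | _     = refl
... | true  | true  = refl
... | true  | false
  with () ← trans (sym (<ᵇ-true (<-≤-trans (<ᵇ-true⇒ j<M) M≤h))) (trans (sym (odd-<ᵇ j k)) odd<k)

u⌊k/2⌋∈won□ : ∀ {k M} → ⌊ k /2⌋ < M → won□ k M (u ⌊ k /2⌋) ≡ true
u⌊k/2⌋∈won□ {k} h<M = cong₂ _∧_ (<ᵇ-true h<M) (cong not (trans (odd-<ᵇ ⌊ k /2⌋ k) (<ᵇ-false {⌊ k /2⌋} ≤-refl)))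

won□-∩-prefix : ∀ {k′} M → parityPlayer k′ ≡ ◇ → ∀ a → won□ k′ M a ∧ prefix (suc k′) M a ≡ won□ (suc k′) M a
won□-∩-prefix M even (v i) = refl
won□-∩-prefix {k′} M even (u j) =
  trans (absorb (j <ᵇ M) _) (cong (λ b → (j <ᵇ M) ∧ not b) (sym (odd<ᵇsuc-even {j} {k′} even)))
  where
    absorb : ∀ a b → (a ∧ b) ∧ a ≡ a ∧ b
    absorb true  b = ∧-identityʳ b
    absorb false b = refl

won□-□-closed : ∀ k M a → attrStepᵛ □ (prefix k M) (won□ k M) a ≡ won□ k M a
won□-□-closed k M (v i) with i <ᵇ k in i<k
... | false = refl
... | true rewrite <ᵇ-pred {i} {k} i<k = refl
won□-□-closed k M (u j) with j <ᵇ M | suc (2 * j) <ᵇ k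
... | true  | true  = refl
... | true  | false = refl
... | false | _     = refl

prefix-minus-won□ : ∀ {k M} → ⌊ k /2⌋ ≤ M → ∀ a → prefix k M a ∧ not (won□ k M a) ≡ prefix k ⌊ k /2⌋ a
prefix-minus-won□         h≤M (v i) = ∧-identityʳ _
prefix-minus-won□ {k} {M} h≤M (u j) with j <ᵇ M in j<M | suc (2 * j) <ᵇ k in odd<k
... | true  | true  = trans (sym odd<k) (odd-<ᵇ j k)
... | true  | false = trans (sym odd<k) (odd-<ᵇ j k)
... | false | _     = sym (<ᵇ-false (≤-trans h≤M (<ᵇ-false⇒ j<M)))

won□-priority : ∀ {k M} a → won□ k M a ≡ true → priority a ≡ 1
won□-priority (u j) _ = refl

won◇-⊆-prefix : ∀ {k′ k M} → k′ ≤ k → ⌊ k′ /2⌋ ≤ M → ∀ a → won◇ k′ a ∧ prefix k M a ≡ won◇ k′ a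
won◇-⊆-prefix {k′} {k} k′≤k h≤M (v i) with i <ᵇ k′ in i<k′
... | false = refl
... | true  = <ᵇ-true (<-≤-trans (<ᵇ-true⇒ i<k′) k′≤k)
won◇-⊆-prefix {k′} {k} {M} k′≤k h≤M (u j) with suc (2 * j) <ᵇ k′ in odd<k′
... | false = refl
... | true  = <ᵇ-true (<-≤-trans (<ᵇ-true⇒ (trans (sym (odd-<ᵇ j k′)) odd<k′)) h≤M)

won◇-◇-step : ∀ {k′} M → 0 < k′ → ∀ a → attrStepᵛ ◇ (prefix (suc k′) M) (won◇ k′) a ≡ won◇ k′ a ∨ top k′ a
won◇-◇-step {suc c} M _ (v zero)    = refl
won◇-◇-step {suc c} M _ (v (suc i)) = along-path i c
  where
    along-path : ∀ i c → (i <ᵇ c) ∨ ((i <ᵇ suc c) ∧ ((i <ᵇ 2 + c) ∧ (i <ᵇ suc c))) ≡ (i <ᵇ c) ∨ (i ≡ᵇ c)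
    along-path zero    zero    = refl
    along-path zero    (suc c) = refl
    along-path (suc i) zero    = refl
    along-path (suc i) (suc c) = along-path i c
won◇-◇-step {suc c} M _ (u j) with 2 * j <ᵇ c | j <ᵇ M | 2 * j <ᵇ suc c
... | true  | _     | _     = refl
... | false | false | _     = refl
... | false | true  | false = refl
... | false | true  | true  = refl

won◇∪top-◇-step : ∀ {k′ M} → ⌊ suc k′ /2⌋ ≤ M → ∀ a →
             attrStepᵛ ◇ (prefix (suc k′) M) (λ b → won◇ k′ b ∨ top k′ b) a ≡ won◇ (suc k′) a
won◇∪top-◇-step {zero}  h≤M (v zero)    = refl
won◇∪top-◇-step {suc c} h≤M (v zero)    = refl
won◇∪top-◇-step {k′}    h≤M (v (suc i)) = along-path i k′
  where
    along-path : ∀ i c → ((suc i <ᵇ c) ∨ (suc i ≡ᵇ c)) ∨ ((i <ᵇ c) ∧ ((i <ᵇ suc c) ∧ ((i <ᵇ c) ∨ (i ≡ᵇ c))))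
                         ≡ (i <ᵇ c)
    along-path zero    zero    = refl
    along-path zero    (suc c) = ∨-zeroʳ _
    along-path (suc i) zero    = refl
    along-path (suc i) (suc c) = along-path i c
won◇∪top-◇-step {k′} {M} h≤M (u j) = via-target (suc (2 * j)) (j <ᵇ M) target-in-M
  where
    target-in-M : (suc (2 * j) ≡ᵇ k′) ≡ true → (j <ᵇ M) ≡ true
    target-in-M e = <ᵇ-true (<-≤-trans (<ᵇ-true⇒ (trans (sym (odd-<ᵇ j (suc k′))) below)) h≤M)
      where
        below : (suc (2 * j) <ᵇ suc k′) ≡ true
        below rewrite sym (≡ᵇ-true⇒ {suc (2 * j)} {k′} e) = <ᵇ-true (n<1+n (suc (2 * j)))
    via-target : ∀ t A → ((t ≡ᵇ k′) ≡ true → A ≡ true) →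
                 ((t <ᵇ k′) ∨ false) ∨
                   (A ∧ ((A ∧ ((t <ᵇ k′) ∨ false)) ∨ ((t <ᵇ suc k′) ∧ ((t <ᵇ k′) ∨ (t ≡ᵇ k′)))))
                 ≡ (t <ᵇ suc k′)
    via-target t A t≡k′⇒A rewrite <ᵇ-suc t k′ with t <ᵇ k′ | t ≡ᵇ k′ | A
    ... | true  | true  | _     = refl
    ... | true  | false | _     = refl
    ... | false | false | true  = refl
    ... | false | false | false = refl
    ... | false | true  | true  = refl
    ... | false | true  | false = contradiction (t≡k′⇒A refl) λ ()

won◇-◇-closed : ∀ k M a → attrStepᵛ ◇ (prefix k M) (won◇ k) a ≡ won◇ k a
won◇-◇-closed k M (v i) with i <ᵇ k
... | true  = refl
... | false = refl
won◇-◇-closed k M (u j) with suc (2 * j) <ᵇ k | j <ᵇ M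
... | true  | _     = refl
... | false | true  = refl
... | false | false = refl

prefix-minus-won◇ : ∀ k M a → prefix k M a ∧ not (won◇ k a) ≡ won□ k M a
prefix-minus-won◇ k M (v i) = ∧-inverseʳ (i <ᵇ k)
prefix-minus-won◇ k M (u j) = refl

prefix0≡won□0 : ∀ M a → prefix 0 M a ≡ won□ 0 M a
prefix0≡won□0 M (v i) = refl
prefix0≡won□0 M (u j) = sym (∧-identityʳ (j <ᵇ M))

won◇0 : ∀ a → won◇ 0 a ≡ false
won◇0 (v i) = refl
won◇0 (u j) = refl

module Run (n : ℕ) where

  open Decoding n
  open ZielonkaFacts (Sn n)

  N : ℕ
  N = 2 * n + n

  attrStep-lift : ∀ p {S X : VSet N} s χ {ψ : Vertex → Bool} → S ≗ s ∘ decode → X ≗ χ ∘ decode →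
                  (∀ a → attrStepᵛ p s χ a ≡ ψ a) → attrStep (Sn n) p S X ≗ ψ ∘ decode
  attrStep-lift p s χ S≗ X≗ step x =
    trans (attrStep-cong p S≗ X≗ x) (trans (attrStep-decode p s χ x) (step (decode x)))

  attr-lift : ∀ p {S U : VSet N} {s χ : Vertex → Bool} j → j ≤ N → S ≗ s ∘ decode →
              iterateˢ j (attrStep (Sn n) p S) (U ∩ˢ S) ≗ χ ∘ decode →
              (∀ a → attrStepᵛ p s χ a ≡ χ a) → attr (Sn n) p S U ≗ χ ∘ decode
  attr-lift p {S} {U} j j≤N S≗ reach closed =
    attr-≗ p S U j j≤N reach (attrStep-lift p _ _ S≗ (λ _ → refl) closed)

  prefix-full : ∀ a → InRange a → prefix (2 * n) n a ≡ true
  prefix-full (v i) i<2n = <ᵇ-true i<2n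
  prefix-full (u j) j<n  = <ᵇ-true j<n

  record Admissible (k M : ℕ) : Set where
    constructor admissible
    field
      k≤2n   : k ≤ 2 * n
      M≤n    : M ≤ n
      half≤M : ⌊ k /2⌋ ≤ M

  Outcome : ℕ → ℕ → (VSet N × VSet N) × ℕ → Set
  Outcome k M = Computes ◇ (won◇ k ∘ decode) (won□ k M ∘ decode) (2 ^ (⌈ k /2⌉ ⊓ M))

  PrefixRuns : ℕ → Set
  PrefixRuns f = ∀ k M S → S ≗ prefix k M ∘ decode → Admissible k M → k + M < f →
                 Outcome k M (zielonkaF (Sn n) f S)

  runs-base : ∀ {f M S} → S ≗ prefix 0 M ∘ decode → M < f → Outcome 0 M (zielonkaF (Sn n) f S)
  runs-base {suc f} {zero} {S} S≗ _ =
    subst (Outcome 0 0) (sym (zielonkaF-on-empty (λ x → trans (S≗ x) (empty (decode x)))))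
      ((λ x → sym (won◇0 (decode x))) , (λ x → sym (won□-empty z≤n (decode x))) , ≤-refl)
    where
      empty : ∀ a → prefix 0 0 a ≡ false
      empty a = trans (prefix0≡won□0 0 a) (won□-empty z≤n a)
  runs-base {suc zero}    {suc M} _ (s≤s ())
  runs-base {suc (suc f)} {suc M} {S} S≗ _ =
    (λ x → trans (proj₁ (proj₂ all-odd) x) (sym (won◇0 (decode x)))) ,
    (λ x → trans (proj₁ all-odd x) (trans (S≗ x) (prefix0≡won□0 (suc M) (decode x)))) ,
    proj₂ (proj₂ all-odd)
    where
      all-odd : Computes □ S ∅ˢ 1 (zielonkaF (Sn n) (suc (suc f)) S)
      all-odd = zielonkaF-uniform (s≤s (s≤s z≤n)) λ x Sx →
        trans (prio-decode x)
              (won□-priority (decode x) (trans (sym (prefix0≡won□0 (suc M) (decode x))) (trans (sym (S≗ x)) Sx)))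

  module TopRemoved {f k′ M : ℕ} {S : VSet N} (IH : PrefixRuns f) (S≗ : S ≗ prefix (suc k′) M ∘ decode)
                    (adm : Admissible (suc k′) M) (fuel : suc k′ + M < suc f) where

    open Admissible adm

    top-in-S : ∃ λ x → S x ≡ true × decode x ≡ v k′
    top-in-S with x , x↦ ← decode-onto (v k′) k≤2n =
      x , trans (S≗ x) (trans (cong (prefix (suc k′) M) x↦) (<ᵇ-true (n<1+n k′))) , x↦

    S≢∅ : nonEmpty S ≡ true
    S≢∅ with x , Sx , _ ← top-in-S = nonEmpty-intro x Sx

    max≡ : maxPrio (Sn n) S ≡ 2 + k′
    max≡ with x , Sx , x↦ ← top-in-S =
      maxPrio-≡ x Sx (trans (prio-decode x) (cong priority x↦))
        (λ y Sy → subst (_≤ 2 + k′) (sym (prio-decode y))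
                        (prefix-priority≤ k′ M (decode y) (trans (sym (S≗ y)) Sy)))

    top≗ : ((λ x → S x ∧ (prio (Sn n) x ≡ᵇ 2 + k′)) ∩ˢ S) ≗ top k′ ∘ decode
    top≗ x rewrite S≗ x | prio-decode x = prefix-maxPriority≡top k′ M (decode x)

    first-outcome : ∀ {A} → A ≗ top k′ ∘ decode → Outcome k′ M (zielonkaF (Sn n) f (S ∖ˢ A))
    first-outcome A≗ = IH k′ M (S ∖ˢ _) minus-top
                         (admissible (<⇒≤ k≤2n) M≤n (≤-trans (⌊n/2⌋-mono (n≤1+n k′)) half≤M)) (≤-pred fuel)
      where
        minus-top : (S ∖ˢ _) ≗ prefix k′ M ∘ decode
        minus-top x = trans (cong₂ (λ s a → s ∧ not a) (S≗ x) (A≗ x)) (prefix-minus-top k′ M (decode x))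

    module EvenTop (even : parityPlayer k′ ≡ ◇) where

      open Unfold f S (2 + k′) ◇

      A≗ : A ≗ top k′ ∘ decode
      A≗ = attr-lift ◇ 0 z≤n S≗ top≗ (top-◇-closed M even)

      first-ok : Outcome k′ M first
      first-ok = first-outcome A≗

      h≡ : ⌊ suc k′ /2⌋ ≡ ⌊ k′ /2⌋
      h≡ = ⌊suc/2⌋-even even

      no-second-call : M ≤ ⌊ k′ /2⌋ → Outcome (suc k′) M (zielonkaF (Sn n) (suc f) S)
      no-second-call M≤h = subst (Outcome (suc k′) M) (sym (unfold-no-second S≢∅ max≡ even nothing-lost))
                             (W◇ , W□ , m≤n⇒m≤1+n count)
        where
          M≤h′ : M ≤ ⌊ suc k′ /2⌋
          M≤h′ = subst (M ≤_) (sym h≡) M≤h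
          nothing-lost : nonEmpty (proj₂ (proj₁ first)) ≡ false
          nothing-lost = nonEmpty-≡-false λ x → trans (proj₁ (proj₂ first-ok) x) (won□-empty M≤h (decode x))
          W◇ : (A ∪ˢ proj₁ (proj₁ first)) ≗ won◇ (suc k′) ∘ decode
          W◇ x = trans (cong₂ _∨_ (A≗ x) (proj₁ first-ok x)) (top∪won◇ even (decode x))
          W□ : ∅ˢ ≗ won□ (suc k′) M ∘ decode
          W□ x = sym (won□-empty M≤h′ (decode x))
          same-exponent : ⌈ k′ /2⌉ ⊓ M ≡ ⌈ suc k′ /2⌉ ⊓ M
          same-exponent = trans (m≥n⇒m⊓n≡n M≤h′) (sym (m≥n⇒m⊓n≡n (m≤n⇒m≤1+n M≤h)))
          count : 2 ^ (⌈ suc k′ /2⌉ ⊓ M) ≤ proj₂ first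
          count = subst (λ e → 2 ^ e ≤ proj₂ first) same-exponent (proj₂ (proj₂ first-ok))

      second-call : ⌊ k′ /2⌋ < M → Outcome (suc k′) M (zielonkaF (Sn n) (suc f) S)
      second-call h<M = subst (Outcome (suc k′) M) (sym (unfold-second S≢∅ max≡ even lost-something))
                          (proj₁ second-ok , W□ , count)
        where
          k h : ℕ
          k = suc k′
          h = ⌊ k /2⌋
          lost-something : nonEmpty (proj₂ (proj₁ first)) ≡ true
          lost-something with x , x↦ ← decode-onto (u ⌊ k′ /2⌋) (<-≤-trans h<M M≤n) =
            nonEmpty-intro x (trans (proj₁ (proj₂ first-ok) x) (trans (cong (won□ k′ M) x↦) (u⌊k/2⌋∈won□ h<M)))
          B≗ : B ≗ won□ k M ∘ decode
          B≗ = attr-lift □ 0 z≤n S≗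
                 (λ x → trans (cong₂ _∧_ (proj₁ (proj₂ first-ok) x) (S≗ x)) (won□-∩-prefix M even (decode x)))
                 (won□-□-closed k M)
          second-ok : Outcome k h second
          second-ok = IH k h (S ∖ˢ B)
                        (λ x → trans (cong₂ (λ s b → s ∧ not b) (S≗ x) (B≗ x))
                                     (prefix-minus-won□ half≤M (decode x)))
                        (admissible k≤2n (≤-trans half≤M M≤n) ≤-refl)
                        (<-≤-trans (+-monoʳ-< k (subst (_< M) (sym h≡) h<M)) (≤-pred fuel))
          W□ : (proj₂ (proj₁ second) ∪ˢ B) ≗ won□ k M ∘ decode
          W□ x = cong₂ _∨_ (trans (proj₁ (proj₂ second-ok) x) (won□-empty ≤-refl (decode x))) (B≗ x)
          count : 2 ^ (⌈ k /2⌉ ⊓ M) ≤ suc (proj₂ first + proj₂ second)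
          count = subst (_≤ suc (proj₂ first + proj₂ second)) (cong (2 ^_) (sym (m≤n⇒m⊓n≡m h<M)))
                    (2^-double {⌊ k′ /2⌋}
                      (subst (λ e → 2 ^ e ≤ proj₂ first) (trans (cong (_⊓ M) h≡) (m≤n⇒m⊓n≡m (<⇒≤ h<M)))
                             (proj₂ (proj₂ first-ok)))
                      (subst (λ e → 2 ^ e ≤ proj₂ second) (trans (cong (suc ⌊ k′ /2⌋ ⊓_) h≡) (m≥n⇒m⊓n≡n (n≤1+n _)))
                             (proj₂ (proj₂ second-ok))))

      result : Outcome (suc k′) M (zielonkaF (Sn n) (suc f) S)
      result with ⌊ k′ /2⌋ <? M
      ... | yes h<M = second-call h<M
      ... | no  h≮M = no-second-call (≮⇒≥ h≮M)

    module OddTop (odd : parityPlayer k′ ≡ □) where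

      open Unfold f S (2 + k′) □

      k : ℕ
      k = suc k′

      0<k′ : 0 < k′
      0<k′ = odd⇒positive odd

      A≗ : A ≗ top k′ ∘ decode
      A≗ = attr-lift □ 0 z≤n S≗ top≗ (top-□-closed k′ M)

      first-ok : Outcome k′ M first
      first-ok = first-outcome A≗

      v₀-won : nonEmpty (proj₁ (proj₁ first)) ≡ true
      v₀-won with x , x↦ ← decode-onto (v 0) (≤-<-trans z≤n k≤2n) =
        nonEmpty-intro x (trans (proj₁ first-ok x) (trans (cong (won◇ k′) x↦) (<ᵇ-true 0<k′)))

      B≗ : B ≗ won◇ k ∘ decode
      B≗ = attr-lift ◇ 2 2≤N S≗
             (attrStep-lift ◇ (prefix k M) (λ b → won◇ k′ b ∨ top k′ b) S≗
                (attrStep-lift ◇ (prefix k M) (won◇ k′) S≗ X₀ (won◇-◇-step M 0<k′)) (won◇∪top-◇-step half≤M))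
             (won◇-◇-closed k M)
        where
          2≤N : 2 ≤ N
          2≤N = ≤-trans (s≤s 0<k′) (≤-trans k≤2n (m≤m+n (2 * n) n))
          X₀ : (proj₁ (proj₁ first) ∩ˢ S) ≗ won◇ k′ ∘ decode
          X₀ x = trans (cong₂ _∧_ (proj₁ first-ok x) (S≗ x))
                       (won◇-⊆-prefix (n≤1+n k′) (≤-trans (⌊n/2⌋-mono (n≤1+n k′)) half≤M) (decode x))

      S∖B≗ : (S ∖ˢ B) ≗ won□ k M ∘ decode
      S∖B≗ x = trans (cong₂ (λ s b → s ∧ not b) (S≗ x) (B≗ x)) (prefix-minus-won◇ k M (decode x))

      second-ok : Computes □ (S ∖ˢ B) ∅ˢ 1 second
      second-ok = zielonkaF-uniform (≤-trans (s≤s 0<k′) (≤-trans (m≤m+n k M) (≤-pred fuel))) λ x e →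
                    trans (prio-decode x) (won□-priority (decode x) (trans (sym (S∖B≗ x)) e))

      result : Outcome k M (zielonkaF (Sn n) (suc f) S)
      result = subst (Outcome k M) (sym (unfold-second S≢∅ max≡ odd v₀-won))
                 ((λ x → cong₂ _∨_ (proj₁ (proj₂ second-ok) x) (B≗ x)) ,
                  (λ x → trans (proj₁ second-ok x) (S∖B≗ x)) ,
                  m≤n⇒m≤1+n (≤-trans count (m≤m+n _ _)))
        where
          count : 2 ^ (⌈ k /2⌉ ⊓ M) ≤ proj₂ first
          count = subst (λ e → 2 ^ (e ⊓ M) ≤ proj₂ first) (⌊suc/2⌋-odd odd) (proj₂ (proj₂ first-ok))

  runs : ∀ f → PrefixRuns f
  runs zero    _        _ _ _  _   ()
  runs (suc f) zero     M S S≗ adm fuel = runs-base S≗ fuel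
  runs (suc f) (suc k′) M S S≗ adm fuel with parityPlayer k′ in par
  ... | ◇ = TopRemoved.EvenTop.result (runs f) S≗ adm fuel par
  ... | □ = TopRemoved.OddTop.result  (runs f) S≗ adm fuel par

-- The bound holds for n = 0 too, so the hypothesis 1 ≤ n is unused.
proposition5 : (n : ℕ) → 1 ≤ n → 2 ^ n ≤ zielonkaCalls (Sn n)
proposition5 n _ = subst (_≤ zielonkaCalls (Sn n)) (cong (2 ^_) exponent) (proj₂ (proj₂ whole-game))
  where
    open Decoding n
    open Run n
    whole-game : Outcome (2 * n) n (zielonkaF (Sn n) (suc N) fullˢ)
    whole-game = runs (suc N) (2 * n) n fullˢ (λ x → sym (prefix-full (decode x) (decode-inRange x)))
                   (admissible ≤-refl ≤-refl (≤-reflexive (⌊2n/2⌋≡n n))) ≤-refl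
    exponent : ⌈ 2 * n /2⌉ ⊓ n ≡ n
    exponent = trans (cong (_⊓ n) (⌈2n/2⌉≡n n)) (⊓-idem n)
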